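{- Let $v,w\in\{a,b\}^*$. If $\lambda_v(w)$ is a Christoffel word, then $w$ is a Christoffel word.
   Context: Alphabet $\{a,b\}$. The palindromization map $\psi$: $\psi(\varepsilon)=\varepsilon$, $\psi(ux)=(\psi(u)x)^{(+)}$ for a word $u$ and letter $x$, where $z^{(+)}$ is the shortest palindrome having $z$ as a prefix. The Christoffel words are the letters $a$, $b$ and the words $a\psi(u)b$ with $u\in\{a,b\}^*$. Let $\lambda_a$ be the morphism $a\mapsto a$, $b\mapsto ab$, and $\lambda_b$ the morphism $a\mapsto ab$, $b\mapsto b$. For $v=v_1\cdots v_n$ with letters $v_i$, $\lambda_v=\lambda_{v_1}\circ\cdots\circ\lambda_{v_n}$, and $\lambda_\varepsilon$ is the identity. -}

module Defs where

open import Data.List using (List; []; _∷_; _++_; reverse; concatMap; [_])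
open import Data.Product using (∃; _×_)
open import Data.Sum using (_⊎_)
open import Relation.Binary.PropositionalEquality using (_≡_)
open import Relation.Nullary using (Dec; yes; no)
open import Relation.Nullary.Decidable using (map′)
open import Data.List.Properties using (≡-dec)

data Letter : Set where
  a b : Letter

_≟L_ : (x y : Letter) → Dec (x ≡ y)
a ≟L a = yes _≡_.refl
a ≟L b = no (λ ())
b ≟L a = no (λ ())
b ≟L b = yes _≡_.refl

Word : Set
Word = List Letter

_≟W_ : (u v : Word) → Dec (u ≡ v)
_≟W_ = ≡-dec _≟L_

isPal? : (w : Word) → Dec (w ≡ reverse w)
isPal? w = w ≟W reverse w

-- Palindromic closure z⁽⁺⁾: the shortest palindrome having z as a prefix.
-- Writing z = p s with s the longest palindromic suffix of z, z⁽⁺⁾ = z · reverse p.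
-- closureAux p s: scan splits z = p ++ s with p increasing (so s decreasing);
-- the first palindromic s is the longest palindromic suffix.
closureAux : Word → Word → Word
closureAux p [] = reverse p   -- empty suffix is always a palindrome
closureAux p (x ∷ s) with isPal? (x ∷ s)
... | yes _ = reverse p
... | no  _ = closureAux (p ++ [ x ]) s

palClosure : Word → Word
palClosure z = z ++ closureAux [] z

-- the palindromization map ψ: ψ(ε) = ε, ψ(u x) = (ψ(u) x)⁽⁺⁾
-- processed left to right via an accumulator
psiFrom : Word → Word → Word
psiFrom acc [] = acc
psiFrom acc (x ∷ u) = psiFrom (palClosure (acc ++ [ x ])) u

psi : Word → Word
psi u = psiFrom [] u

IsChristoffel : Word → Set
IsChristoffel w = (w ≡ [ a ]) ⊎ ((w ≡ [ b ]) ⊎ ∃ (λ u → w ≡ a ∷ (psi u ++ [ b ])))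

lamLetter : Letter → Letter → Word
lamLetter a a = a ∷ []
lamLetter a b = a ∷ b ∷ []
lamLetter b a = a ∷ b ∷ []
lamLetter b b = b ∷ []

lam1 : Letter → Word → Word
lam1 x w = concatMap (lamLetter x) w

lam : Word → Word → Word
lam [] w = w
lam (x ∷ v) w = lam1 x (lam v w)

{-# OPTIONS --safe #-}
module Submission where

-- By induction on v it suffices to show that λ_x(w) Christoffel implies w Christoffel.
-- The key is Justin's formula ψ(xu) = μ_x(ψ(u)) x, where μ_a = λ_a and μ_b : a ↦ ba, b ↦ b;
-- it gives a ψ(xu) b = λ_x(a ψ(u) b). Since λ_x is injective, and λ_a(w) = λ_b(a m b) and
-- λ_b(w) = λ_a(a m b) are impossible, the Christoffel word λ_x(w) = a ψ(yu) b forces y = x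
-- and w = a ψ(u) b. Justin's formula holds because z ↦ μ_x(z) x commutes with palindromic
-- closure: it maps palindromes to palindromes and the longest palindromic suffix of z to that
-- of μ_x(z) x. For y ≠ x every y in μ_x(p) x is preceded by x, so the longest palindromic
-- suffix of μ_x(p) x y is preceded by x and appending x does not change the closure; hence
-- (μ_x(p) x y)⁺ = (μ_x(p y) x)⁺ = μ_x((p y)⁺) x, and ψ is built from such closures.

open import Defs
open import Data.List using ([]; _∷_; _++_; _∷ʳ_; reverse; concatMap; [_]; initLast; _∷ʳ′_)
open import Data.List.Properties using (++-assoc; ++-identityʳ; ∷-injective; ∷-injectiveʳ; ∷ʳ-injective; ∷ʳ-injectiveˡ; ∷ʳ-injectiveʳ; reverse-++; unfold-reverse; concatMap-++)
open import Data.Product using (∃; ∃₂; _×_; _,_)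
open import Data.Sum using (inj₁; inj₂)
open import Data.Empty using (⊥-elim)
open import Function using (_∘_)
open import Relation.Binary.PropositionalEquality using (_≡_; _≢_; refl; sym; trans; cong; subst; module ≡-Reasoning)
open import Relation.Nullary using (¬_; yes; no)

Palindrome : Word → Set
Palindrome w = w ≡ reverse w

reverse-∷-∷ʳ : ∀ {A : Set} (e : A) m d → reverse (e ∷ m ∷ʳ d) ≡ d ∷ reverse m ∷ʳ e
reverse-∷-∷ʳ e m d = trans (unfold-reverse e (m ∷ʳ d)) (cong (_∷ʳ e) (reverse-++ m [ d ]))

palindrome-∷-∷ʳ⁻ : ∀ {e m d} → Palindrome (e ∷ m ∷ʳ d) → e ≡ d × Palindrome m
palindrome-∷-∷ʳ⁻ {e} {m} {d} pal with ∷-injective (trans pal (reverse-∷-∷ʳ e m d))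
... | refl , eq = refl , ∷ʳ-injectiveˡ m (reverse m) eq

palindrome-∷-∷ʳ : ∀ e {m} → Palindrome m → Palindrome (e ∷ m ∷ʳ e)
palindrome-∷-∷ʳ e {m} pal = trans (cong (λ w → e ∷ w ∷ʳ e) pal) (sym (reverse-∷-∷ʳ e m e))

NoLongerPalSuffix : Word → Word → Set
NoLongerPalSuffix t s = ∀ u e v → t ≡ u ++ e ∷ v → ¬ Palindrome (e ∷ v ++ s)

LongestPalSuffix : Word → Word → Set
LongestPalSuffix t s = Palindrome s × NoLongerPalSuffix t s

closureAux-longest : ∀ p t {s} → LongestPalSuffix t s → closureAux p (t ++ s) ≡ reverse (p ++ t)
closureAux-longest p [] {[]} _ = cong reverse (sym (++-identityʳ p))
closureAux-longest p [] {e ∷ s} (pal , _) with isPal? (e ∷ s)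
... | yes _ = cong reverse (sym (++-identityʳ p))
... | no ¬pal = ⊥-elim (¬pal pal)
closureAux-longest p (c ∷ t) {s} (pal , longest) with isPal? (c ∷ t ++ s)
... | yes pal′ = ⊥-elim (longest [] c t refl pal′)
... | no _ = trans (closureAux-longest (p ∷ʳ c) t (pal , λ u e v eq → longest (c ∷ u) e v (cong (c ∷_) eq)))
                   (cong reverse (++-assoc p [ c ] t))

palClosure-longest : ∀ {t s} → LongestPalSuffix t s → palClosure (t ++ s) ≡ t ++ s ++ reverse t
palClosure-longest {t} {s} h = trans (cong ((t ++ s) ++_) (closureAux-longest [] t h)) (++-assoc t s (reverse t))

noLongerPalSuffix-∷ʳ : ∀ {p c z} → NoLongerPalSuffix p (c ∷ z) → ¬ Palindrome (c ∷ z) →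
                       NoLongerPalSuffix (p ∷ʳ c) z
noLongerPalSuffix-∷ʳ {p} longest ¬pal u e v eq with initLast v
... | [] with ∷ʳ-injective p u eq
...   | refl , refl = ¬pal
noLongerPalSuffix-∷ʳ {p} {c} {z} longest ¬pal u e v eq | v₀ ∷ʳ′ d
  with ∷ʳ-injective p (u ++ e ∷ v₀) (trans eq (sym (++-assoc u (e ∷ v₀) [ d ])))
...   | refl , refl = longest u e v₀ refl ∘ subst Palindrome (++-assoc (e ∷ v₀) [ c ] z)

longestPalSuffix-from : ∀ p z → NoLongerPalSuffix p z → ∃₂ λ t s → p ++ z ≡ t ++ s × LongestPalSuffix t s
longestPalSuffix-from p [] longest = p , [] , refl , refl , longest
longestPalSuffix-from p (c ∷ z) longest with isPal? (c ∷ z)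
... | yes pal = p , c ∷ z , refl , pal , longest
... | no ¬pal with longestPalSuffix-from (p ∷ʳ c) z (noLongerPalSuffix-∷ʳ longest ¬pal)
...   | t , s , eq , h = t , s , trans (sym (++-assoc p [ c ] z)) eq , h

longestPalSuffix : ∀ z → ∃₂ λ t s → z ≡ t ++ s × LongestPalSuffix t s
longestPalSuffix z = longestPalSuffix-from [] z λ { [] _ _ () ; (_ ∷ _) _ _ () }

palClosure-∷ʳ-absorbed : ∀ {z t d s} → z ≡ (t ∷ʳ d) ++ s → LongestPalSuffix (t ∷ʳ d) s →
                         palClosure (z ∷ʳ d) ≡ palClosure z
palClosure-∷ʳ-absorbed {t = t} {d} {s} refl h@(pal , longest) = begin
  palClosure (((t ∷ʳ d) ++ s) ∷ʳ d)   ≡⟨ cong palClosure (trans (++-assoc (t ∷ʳ d) s [ d ]) (++-assoc t [ d ] (s ∷ʳ d))) ⟩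
  palClosure (t ++ d ∷ s ∷ʳ d)        ≡⟨ palClosure-longest (palindrome-∷-∷ʳ d pal , wrapped) ⟩
  t ++ d ∷ (s ∷ʳ d) ++ reverse t      ≡⟨ cong (λ w → t ++ d ∷ w) (++-assoc s [ d ] (reverse t)) ⟩
  t ++ d ∷ s ++ d ∷ reverse t         ≡⟨ sym (++-assoc t [ d ] (s ++ d ∷ reverse t)) ⟩
  (t ∷ʳ d) ++ s ++ d ∷ reverse t      ≡⟨ cong (λ w → (t ∷ʳ d) ++ s ++ w) (sym (reverse-++ t [ d ])) ⟩
  (t ∷ʳ d) ++ s ++ reverse (t ∷ʳ d)   ≡⟨ sym (palClosure-longest h) ⟩
  palClosure ((t ∷ʳ d) ++ s)          ∎
  where
  open ≡-Reasoning
  -- A palindrome e v d s d longer than d s d would make v d s a palindrome longer than s.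
  wrapped : NoLongerPalSuffix t (d ∷ s ∷ʳ d)
  wrapped u e v refl pal′ with palindrome-∷-∷ʳ⁻ (subst Palindrome (cong (e ∷_) (sym (++-assoc v (d ∷ s) [ d ]))) pal′)
  wrapped u e [] refl pal′ | refl , inner = longest (u ∷ʳ e) d [] refl inner
  wrapped u e (e′ ∷ v) refl pal′ | refl , inner =
    longest (u ∷ʳ e) e′ (v ∷ʳ d) (trans (++-assoc u (e ∷ e′ ∷ v) [ d ]) (sym (++-assoc u [ e ] (e′ ∷ v ∷ʳ d))))
            (subst Palindrome (cong (e′ ∷_) (sym (++-assoc v [ d ] s))) inner)

lam1-a≢b∷ : ∀ w v → lam1 a w ≢ b ∷ v
lam1-a≢b∷ [] _ ()
lam1-a≢b∷ (a ∷ _) _ ()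
lam1-a≢b∷ (b ∷ _) _ ()

lam1-injective : ∀ x {w w′} → lam1 x w ≡ lam1 x w′ → w ≡ w′
lam1-injective x {[]} {[]} _ = refl
lam1-injective a {[]} {a ∷ _} ()
lam1-injective a {[]} {b ∷ _} ()
lam1-injective a {a ∷ _} {[]} ()
lam1-injective a {b ∷ _} {[]} ()
lam1-injective a {a ∷ w} {a ∷ w′} eq = cong (a ∷_) (lam1-injective a (∷-injectiveʳ eq))
lam1-injective a {a ∷ w} {b ∷ _} eq = ⊥-elim (lam1-a≢b∷ w _ (∷-injectiveʳ eq))
lam1-injective a {b ∷ _} {a ∷ w′} eq = ⊥-elim (lam1-a≢b∷ w′ _ (sym (∷-injectiveʳ eq)))
lam1-injective a {b ∷ w} {b ∷ w′} eq = cong (b ∷_) (lam1-injective a (∷-injectiveʳ (∷-injectiveʳ eq)))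
lam1-injective b {[]} {a ∷ _} ()
lam1-injective b {[]} {b ∷ _} ()
lam1-injective b {a ∷ _} {[]} ()
lam1-injective b {b ∷ _} {[]} ()
lam1-injective b {a ∷ w} {a ∷ w′} eq = cong (a ∷_) (lam1-injective b (∷-injectiveʳ (∷-injectiveʳ eq)))
lam1-injective b {a ∷ _} {b ∷ _} ()
lam1-injective b {b ∷ _} {a ∷ _} ()
lam1-injective b {b ∷ w} {b ∷ w′} eq = cong (b ∷_) (lam1-injective b (∷-injectiveʳ eq))

-- μ_a is λ_a on the nose, so mu a w and lam1 a w are definitionally equal.
muLetter : Letter → Letter → Word
muLetter a c = lamLetter a c
muLetter b a = b ∷ a ∷ []
muLetter b b = b ∷ []

mu : Letter → Word → Word
mu x = concatMap (muLetter x)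

muˣ : Letter → Word → Word
muˣ x w = mu x w ∷ʳ x

mu-++ : ∀ x u w → mu x (u ++ w) ≡ mu x u ++ mu x w
mu-++ x = concatMap-++ (muLetter x)

muˣ-++ : ∀ x u w → muˣ x (u ++ w) ≡ mu x u ++ muˣ x w
muˣ-++ x u w = trans (cong (_∷ʳ x) (mu-++ x u w)) (++-assoc (mu x u) (mu x w) [ x ])

mu-∷ʳ : ∀ x p c → mu x (p ∷ʳ c) ≡ mu x p ++ muLetter x c
mu-∷ʳ x p c = trans (mu-++ x p [ c ]) (cong (mu x p ++_) (++-identityʳ (muLetter x c)))

muˣ-∷ʳ-self : ∀ x p → muˣ x (p ∷ʳ x) ≡ muˣ x p ∷ʳ x
muˣ-∷ʳ-self a p = cong (_∷ʳ a) (mu-∷ʳ a p a)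
muˣ-∷ʳ-self b p = cong (_∷ʳ b) (mu-∷ʳ b p b)

mu-∷ʳ-other : ∀ {x y} → y ≢ x → ∀ p → mu x (p ∷ʳ y) ≡ muˣ x p ∷ʳ y
mu-∷ʳ-other {a} {a} y≢x _ = ⊥-elim (y≢x refl)
mu-∷ʳ-other {a} {b} _ p = trans (mu-∷ʳ a p b) (sym (++-assoc (mu a p) [ a ] [ b ]))
mu-∷ʳ-other {b} {a} _ p = trans (mu-∷ʳ b p a) (sym (++-assoc (mu b p) [ b ] [ a ]))
mu-∷ʳ-other {b} {b} y≢x _ = ⊥-elim (y≢x refl)

muLetter-conjugate : ∀ x c → x ∷ reverse (muLetter x c) ≡ muLetter x c ∷ʳ x
muLetter-conjugate a a = refl
muLetter-conjugate a b = refl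
muLetter-conjugate b a = refl
muLetter-conjugate b b = refl

∷-reverse-mu : ∀ x w → x ∷ reverse (mu x w) ≡ muˣ x (reverse w)
∷-reverse-mu x [] = refl
∷-reverse-mu x (c ∷ w) = begin
  x ∷ reverse (muLetter x c ++ mu x w)               ≡⟨ cong (x ∷_) (reverse-++ (muLetter x c) (mu x w)) ⟩
  (x ∷ reverse (mu x w)) ++ reverse (muLetter x c)   ≡⟨ cong (_++ reverse (muLetter x c)) (∷-reverse-mu x w) ⟩
  muˣ x (reverse w) ++ reverse (muLetter x c)        ≡⟨ ++-assoc (mu x (reverse w)) [ x ] _ ⟩
  mu x (reverse w) ++ x ∷ reverse (muLetter x c)     ≡⟨ cong (mu x (reverse w) ++_) (muLetter-conjugate x c) ⟩
  mu x (reverse w) ++ muLetter x c ∷ʳ x              ≡⟨ sym (++-assoc (mu x (reverse w)) (muLetter x c) [ x ]) ⟩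
  (mu x (reverse w) ++ muLetter x c) ∷ʳ x            ≡⟨ cong (_∷ʳ x) (sym (mu-∷ʳ x (reverse w) c)) ⟩
  muˣ x (reverse w ∷ʳ c)                             ≡⟨ cong (muˣ x) (sym (unfold-reverse c w)) ⟩
  muˣ x (reverse (c ∷ w))                            ∎
  where open ≡-Reasoning

reverse-muˣ : ∀ x w → reverse (muˣ x w) ≡ muˣ x (reverse w)
reverse-muˣ x w = trans (reverse-++ (mu x w) [ x ]) (∷-reverse-mu x w)

muˣ-b : ∀ w → muˣ b w ≡ b ∷ lam1 b w
muˣ-b [] = refl
muˣ-b (a ∷ w) = cong (λ v → b ∷ a ∷ v) (muˣ-b w)
muˣ-b (b ∷ w) = cong (b ∷_) (muˣ-b w)

muˣ-injective : ∀ x {w w′} → muˣ x w ≡ muˣ x w′ → w ≡ w′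
muˣ-injective a {w} {w′} eq = lam1-injective a (∷ʳ-injectiveˡ (mu a w) (mu a w′) eq)
muˣ-injective b {w} {w′} eq = lam1-injective b (∷-injectiveʳ (trans (sym (muˣ-b w)) (trans eq (muˣ-b w′))))

palindrome-muˣ : ∀ x {w} → Palindrome w → Palindrome (muˣ x w)
palindrome-muˣ x {w} pal = trans (cong (muˣ x) pal) (sym (reverse-muˣ x w))

palindrome-muˣ⁻ : ∀ x {w} → Palindrome (muˣ x w) → Palindrome w
palindrome-muˣ⁻ x {w} pal = muˣ-injective x (trans pal (reverse-muˣ x w))

mu-suffix-from-x : ∀ x t {u v} → mu x t ≡ u ++ x ∷ v → ∃₂ λ t₁ t₂ → t ≡ t₁ ++ t₂ × x ∷ v ≡ mu x t₂
mu-suffix-from-x x [] {[]} ()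
mu-suffix-from-x x [] {_ ∷ _} ()
mu-suffix-from-x x (c ∷ t) {[]} eq = [] , c ∷ t , refl , sym eq
mu-suffix-from-x a (a ∷ t) {_ ∷ _} eq with mu-suffix-from-x a t (∷-injectiveʳ eq)
... | t₁ , t₂ , refl , sfx = a ∷ t₁ , t₂ , refl , sfx
mu-suffix-from-x a (b ∷ t) {_ ∷ []} ()
mu-suffix-from-x a (b ∷ t) {_ ∷ _ ∷ _} eq with mu-suffix-from-x a t (∷-injectiveʳ (∷-injectiveʳ eq))
... | t₁ , t₂ , refl , sfx = b ∷ t₁ , t₂ , refl , sfx
mu-suffix-from-x b (a ∷ t) {_ ∷ []} ()
mu-suffix-from-x b (a ∷ t) {_ ∷ _ ∷ _} eq with mu-suffix-from-x b t (∷-injectiveʳ (∷-injectiveʳ eq))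
... | t₁ , t₂ , refl , sfx = a ∷ t₁ , t₂ , refl , sfx
mu-suffix-from-x b (b ∷ t) {_ ∷ _} eq with mu-suffix-from-x b t (∷-injectiveʳ eq)
... | t₁ , t₂ , refl , sfx = b ∷ t₁ , t₂ , refl , sfx

-- A longer palindromic suffix of μ_x(t) μ_x(s) x must start with x, hence at the image of a
-- letter of t, and it would then be the image of a palindromic suffix of t s longer than s.
longestPalSuffix-muˣ : ∀ x {t s} → LongestPalSuffix t s → LongestPalSuffix (mu x t) (muˣ x s)
longestPalSuffix-muˣ x {t} {s} (pal , longest) = palindrome-muˣ x pal , noLonger
  where
  noLonger : NoLongerPalSuffix (mu x t) (muˣ x s)
  noLonger u e v eq pal′ with palindrome-∷-∷ʳ⁻ (subst Palindrome (cong (e ∷_) (sym (++-assoc v (mu x s) [ x ]))) pal′)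
  ... | refl , _ with mu-suffix-from-x x t eq
  ...   | _ , [] , _ , ()
  ...   | t₁ , c ∷ t₂ , refl , sfx =
    longest t₁ c t₂ refl (palindrome-muˣ⁻ x (subst Palindrome (trans (cong (_++ muˣ x s) sfx) (sym (muˣ-++ x (c ∷ t₂) s))) pal′))

palClosure-muˣ : ∀ x w → palClosure (muˣ x w) ≡ muˣ x (palClosure w)
palClosure-muˣ x w with longestPalSuffix w
... | t , s , refl , h = begin
  palClosure (muˣ x (t ++ s))                ≡⟨ cong palClosure (muˣ-++ x t s) ⟩
  palClosure (mu x t ++ muˣ x s)             ≡⟨ palClosure-longest (longestPalSuffix-muˣ x h) ⟩
  mu x t ++ muˣ x s ++ reverse (mu x t)      ≡⟨ cong (mu x t ++_) (++-assoc (mu x s) [ x ] (reverse (mu x t))) ⟩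
  mu x t ++ mu x s ++ x ∷ reverse (mu x t)   ≡⟨ cong (λ r → mu x t ++ mu x s ++ r) (∷-reverse-mu x t) ⟩
  mu x t ++ mu x s ++ muˣ x (reverse t)      ≡⟨ cong (mu x t ++_) (sym (muˣ-++ x s (reverse t))) ⟩
  mu x t ++ muˣ x (s ++ reverse t)           ≡⟨ sym (muˣ-++ x t (s ++ reverse t)) ⟩
  muˣ x (t ++ s ++ reverse t)                ≡⟨ cong (muˣ x) (sym (palClosure-longest h)) ⟩
  muˣ x (palClosure (t ++ s))                ∎
  where open ≡-Reasoning

mu-other-preceded-by-x : ∀ {x y} → y ≢ x → ∀ p t m → t ++ y ∷ m ≡ mu x p → ∃ λ t′ → t ≡ t′ ∷ʳ x
mu-other-preceded-by-x {a} {a} y≢x _ _ _ _ = ⊥-elim (y≢x refl)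
mu-other-preceded-by-x {b} {b} y≢x _ _ _ _ = ⊥-elim (y≢x refl)
mu-other-preceded-by-x _ [] [] _ ()
mu-other-preceded-by-x _ [] (_ ∷ _) _ ()
mu-other-preceded-by-x {a} {b} _ (a ∷ _) [] _ ()
mu-other-preceded-by-x {a} {b} y≢x (a ∷ p) (d ∷ t) m eq with mu-other-preceded-by-x y≢x p t m (∷-injectiveʳ eq)
... | t′ , refl = d ∷ t′ , refl
mu-other-preceded-by-x {a} {b} _ (b ∷ _) [] _ ()
mu-other-preceded-by-x {a} {b} _ (b ∷ _) (_ ∷ []) _ refl = [] , refl
mu-other-preceded-by-x {a} {b} y≢x (b ∷ p) (d ∷ d′ ∷ t) m eq with mu-other-preceded-by-x y≢x p t m (∷-injectiveʳ (∷-injectiveʳ eq))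
... | t′ , refl = d ∷ d′ ∷ t′ , refl
mu-other-preceded-by-x {b} {a} _ (b ∷ _) [] _ ()
mu-other-preceded-by-x {b} {a} y≢x (b ∷ p) (d ∷ t) m eq with mu-other-preceded-by-x y≢x p t m (∷-injectiveʳ eq)
... | t′ , refl = d ∷ t′ , refl
mu-other-preceded-by-x {b} {a} _ (a ∷ _) [] _ ()
mu-other-preceded-by-x {b} {a} _ (a ∷ _) (_ ∷ []) _ refl = [] , refl
mu-other-preceded-by-x {b} {a} y≢x (a ∷ p) (d ∷ d′ ∷ t) m eq with mu-other-preceded-by-x y≢x p t m (∷-injectiveʳ (∷-injectiveʳ eq))
... | t′ , refl = d ∷ d′ ∷ t′ , refl

palindrome-suffix-head : ∀ {z y t e s} → z ∷ʳ y ≡ t ++ e ∷ s → Palindrome (e ∷ s) → e ≡ y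
palindrome-suffix-head {z} {y} {t} {e} {s} eq pal = sym (∷ʳ-injectiveʳ z (t ++ reverse s) (begin
  z ∷ʳ y                  ≡⟨ eq ⟩
  t ++ e ∷ s              ≡⟨ cong (t ++_) (trans pal (unfold-reverse e s)) ⟩
  t ++ reverse s ∷ʳ e     ≡⟨ sym (++-assoc t (reverse s) [ e ]) ⟩
  (t ++ reverse s) ∷ʳ e   ∎))
  where open ≡-Reasoning

longestPalSuffix-muˣ-∷ʳ-other : ∀ {x y} → y ≢ x → ∀ p {t s} → muˣ x p ∷ʳ y ≡ t ++ s →
                                LongestPalSuffix t s → ∃ λ t′ → t ≡ t′ ∷ʳ x
longestPalSuffix-muˣ-∷ʳ-other {x} {y} y≢x p {t} {[]} eq (_ , longest) =
  ⊥-elim (longest (muˣ x p) y [] (trans (sym (++-identityʳ t)) (sym eq)) refl)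
longestPalSuffix-muˣ-∷ʳ-other {x} {y} y≢x p {t} {e ∷ s} eq (pal , _) with palindrome-suffix-head eq pal
... | refl = mu-other-preceded-by-x y≢x (p ∷ʳ y) t s (trans (sym eq) (sym (mu-∷ʳ-other y≢x p)))

palClosure-muˣ-∷ʳ-other : ∀ {x y} → y ≢ x → ∀ p → palClosure (muˣ x p ∷ʳ y ∷ʳ x) ≡ palClosure (muˣ x p ∷ʳ y)
palClosure-muˣ-∷ʳ-other y≢x p with longestPalSuffix (muˣ _ p ∷ʳ _)
... | t , s , eq , h with longestPalSuffix-muˣ-∷ʳ-other y≢x p eq h
...   | t′ , refl = palClosure-∷ʳ-absorbed eq h

palClosure-muˣ-∷ʳ : ∀ x y p → palClosure (muˣ x p ∷ʳ y) ≡ muˣ x (palClosure (p ∷ʳ y))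
palClosure-muˣ-∷ʳ x y p with y ≟L x
... | yes refl = trans (cong palClosure (sym (muˣ-∷ʳ-self x p))) (palClosure-muˣ x (p ∷ʳ x))
... | no y≢x = begin
  palClosure (muˣ x p ∷ʳ y)          ≡⟨ sym (palClosure-muˣ-∷ʳ-other y≢x p) ⟩
  palClosure (muˣ x p ∷ʳ y ∷ʳ x)     ≡⟨ cong (palClosure ∘ (_∷ʳ x)) (sym (mu-∷ʳ-other y≢x p)) ⟩
  palClosure (muˣ x (p ∷ʳ y))        ≡⟨ palClosure-muˣ x (p ∷ʳ y) ⟩
  muˣ x (palClosure (p ∷ʳ y))        ∎
  where open ≡-Reasoning

psiFrom-muˣ : ∀ x u p → psiFrom (muˣ x p) u ≡ muˣ x (psiFrom p u)
psiFrom-muˣ x [] p = refl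
psiFrom-muˣ x (y ∷ u) p =
  trans (cong (λ w → psiFrom w u) (palClosure-muˣ-∷ʳ x y p)) (psiFrom-muˣ x u (palClosure (p ∷ʳ y)))

psi-∷ : ∀ x u → psi (x ∷ u) ≡ muˣ x (psi u)
psi-∷ a u = psiFrom-muˣ a u []
psi-∷ b u = psiFrom-muˣ b u []

lam1-a∷∷ʳb : ∀ x w → lam1 x (a ∷ w ∷ʳ b) ≡ a ∷ muˣ x w ∷ʳ b
lam1-a∷∷ʳb a w = cong (a ∷_) (trans (concatMap-++ (lamLetter a) w [ b ]) (sym (++-assoc (mu a w) [ a ] [ b ])))
lam1-a∷∷ʳb b w = cong (a ∷_) (trans (cong (b ∷_) (concatMap-++ (lamLetter b) w [ b ])) (sym (cong (_∷ʳ b) (muˣ-b w))))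

christoffel-∷ : ∀ y u → a ∷ psi (y ∷ u) ∷ʳ b ≡ lam1 y (a ∷ psi u ∷ʳ b)
christoffel-∷ y u = trans (cong (λ w → a ∷ w ∷ʳ b) (psi-∷ y u)) (sym (lam1-a∷∷ʳb y (psi u)))

lam1-a≢lam1-b-∷ʳb : ∀ w c → lam1 a w ≢ lam1 b (c ∷ʳ b)
lam1-a≢lam1-b-∷ʳb w [] eq = lam1-a≢b∷ w [] eq
lam1-a≢lam1-b-∷ʳb w (b ∷ _) eq = lam1-a≢b∷ w _ eq
lam1-a≢lam1-b-∷ʳb [] (a ∷ _) ()
lam1-a≢lam1-b-∷ʳb (a ∷ w) (a ∷ _) eq = lam1-a≢b∷ w _ (∷-injectiveʳ eq)
lam1-a≢lam1-b-∷ʳb (b ∷ w) (a ∷ c) eq = lam1-a≢lam1-b-∷ʳb w c (∷-injectiveʳ (∷-injectiveʳ eq))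

lam1-b≢lam1-a-a∷ : ∀ w c → lam1 b w ≢ lam1 a (a ∷ c)
lam1-b≢lam1-a-a∷ [] _ ()
lam1-b≢lam1-a-a∷ (b ∷ _) _ ()
lam1-b≢lam1-a-a∷ (a ∷ _) [] ()
lam1-b≢lam1-a-a∷ (a ∷ _) (a ∷ _) ()
lam1-b≢lam1-a-a∷ (a ∷ _) (b ∷ _) ()

lam1-cancel-christoffel : ∀ x y w m → lam1 x w ≡ lam1 y (a ∷ m ∷ʳ b) → w ≡ a ∷ m ∷ʳ b
lam1-cancel-christoffel a a w m = lam1-injective a
lam1-cancel-christoffel b b w m = lam1-injective b
lam1-cancel-christoffel a b w m = ⊥-elim ∘ lam1-a≢lam1-b-∷ʳb w (a ∷ m)
lam1-cancel-christoffel b a w m = ⊥-elim ∘ lam1-b≢lam1-a-a∷ w (m ∷ʳ b)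

isChristoffel-lam1⁻ : ∀ x w → IsChristoffel (lam1 x w) → IsChristoffel w
isChristoffel-lam1⁻ a w (inj₁ eq) = inj₁ (lam1-injective a {w′ = [ a ]} eq)
isChristoffel-lam1⁻ b w (inj₁ eq) = ⊥-elim (lam1-b≢lam1-a-a∷ w [] eq)
isChristoffel-lam1⁻ a w (inj₂ (inj₁ eq)) = ⊥-elim (lam1-a≢lam1-b-∷ʳb w [] eq)
isChristoffel-lam1⁻ b w (inj₂ (inj₁ eq)) = inj₂ (inj₁ (lam1-injective b {w′ = [ b ]} eq))
isChristoffel-lam1⁻ a w (inj₂ (inj₂ ([] , eq))) = inj₂ (inj₁ (lam1-injective a {w′ = [ b ]} eq))
isChristoffel-lam1⁻ b w (inj₂ (inj₂ ([] , eq))) = inj₁ (lam1-injective b {w′ = [ a ]} eq)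
isChristoffel-lam1⁻ x w (inj₂ (inj₂ (y ∷ u , eq))) =
  inj₂ (inj₂ (u , lam1-cancel-christoffel x y w (psi u) (trans eq (christoffel-∷ y u))))

mainTheorem4 : (v w : Word) → IsChristoffel (lam v w) → IsChristoffel w
mainTheorem4 [] w h = h
mainTheorem4 (x ∷ v) w h = mainTheorem4 v w (isChristoffel-lam1⁻ x (lam v w) h)
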